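{- Let $\sigma$ be a simplex with at least two vertices in a finite simplicial complex $K$, and let $\tau\subset\sigma$ be a face with exactly one vertex fewer than $\sigma$. Let $K[\sigma]$ be the complex of all nonempty faces of $\sigma$. Then the graph $\Gamma(K[\sigma]\setminus\{\sigma,\tau\})$ is dismantlable.
   Context: $\Gamma(L)$ for a simplicial complex $L$ is the graph whose vertices are the nonempty simplices of $L$, two distinct simplices being adjacent iff one contains the other. For a graph $G$, $N_G[g]$ is the closed neighbourhood of $g$; $g$ is dominated by $g'\ne g$ if $N_G[g]\subseteq N_G[g']$; $G$ is dismantlable if it has one vertex or its vertices can be listed $g_1,\dots,g_n$ with each $g_i$ ($2\le i\le n$) dominated by another vertex in the subgraph induced by $\{g_1,\dots,g_i\}$. -}

module Defs where

open import Level using (Level; _⊔_)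
open import Data.Nat using (ℕ; suc; _≤_)
open import Data.Fin.Subset using (Subset; _⊆_; Nonempty; ∣_∣)
open import Data.List using (List; []; _∷_; _++_)
open import Data.List.Membership.Propositional using (_∈_)
open import Data.List.Relation.Unary.Unique.Propositional using (Unique)
open import Data.Product using (Σ; ∃; _×_; _,_)
open import Data.Sum using (_⊎_)
open import Relation.Nullary using (¬_)
open import Relation.Binary.PropositionalEquality using (_≡_; _≢_)

record SimplicialComplex (n : ℕ) : Set₁ where
  field
    IsFace    : Subset n → Set
    nonempty  : ∀ s → IsFace s → Nonempty s
    downClosed : ∀ s t → IsFace s → t ⊆ s → Nonempty t → IsFace t
open SimplicialComplex public

InKσ : ∀ {n} → Subset n → Subset n → Set
InKσ σ s = Nonempty s × s ⊆ σ

InKστ : ∀ {n} → Subset n → Subset n → Subset n → Set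
InKστ σ τ s = InKσ σ s × s ≢ σ × s ≢ τ

ΓAdj : ∀ {n} → Subset n → Subset n → Set
ΓAdj s t = s ≢ t × (s ⊆ t ⊎ t ⊆ s)

module _ {a b c : Level} {A : Set a} (Adj : A → A → Set b) where

  InN[_] : List A → A → A → Set (a ⊔ b)
  InN[ W ] g h = h ∈ W × (h ≡ g ⊎ Adj h g)

  DominatedIn : List A → A → A → Set (a ⊔ b)
  DominatedIn W g g' = g' ≢ g × (∀ h → InN[ W ] g h → InN[ W ] g' h)

  -- g₁,…,gₖ listing such that each gᵢ (i ≥ 2) is dominated by another
  -- vertex of the subgraph induced by {g₁,…,gᵢ}
  DismantlingOrder : List A → Set (a ⊔ b)
  DismantlingOrder gs =
    ∀ (pre : List A) (g : A) (suf : List A) →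
      gs ≡ pre ++ (g ∷ suf) → pre ≢ [] →
      Σ A λ g' → g' ∈ pre × DominatedIn (pre ++ (g ∷ [])) g g'

  Dismantlable : (A → Set c) → Set (a ⊔ b ⊔ c)
  Dismantlable V =
    (Σ A λ v → V v × (∀ w → V w → w ≡ v))
    ⊎ (Σ (List A) λ gs → Unique gs × (∀ x → V x → x ∈ gs)
                        × (∀ x → x ∈ gs → V x) × DismantlingOrder gs)

-- Write σ = τ ∪ ⁅ x ⁆ with x ∉ τ. A face g of σ other than σ and τ either
-- contains x, and is then dominated by ⁅ x ⁆, since every face containing x
-- contains ⁅ x ⁆; or it avoids x, and is then dominated by g ∪ ⁅ x ⁆, which is
-- again a face other than σ and τ: it is comparable with every face that
-- contains x and is comparable with g, and contains all faces below g. So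
-- removing first the faces avoiding x, largest first, and then those
-- containing x, leaves ⁅ x ⁆. Only two properties of the family of faces are
-- used: it contains ⁅ x ⁆ and is closed under g ↦ g ∪ ⁅ x ⁆ for g ∌ x.
module Submission where

open import Defs
open import Data.Nat using (ℕ; suc; _≤_)
open import Data.Fin.Subset using (Subset; _⊆_; ∣_∣)
open import Relation.Binary.PropositionalEquality using (_≡_)

open import Data.Nat using (_<_; s≤s⁻¹)
import Data.Bool as Bool
open import Function using (_∘_)
open import Level using (0ℓ)
open import Data.Fin using (Fin; zero)
open import Data.Fin.Properties using (any?)
open import Data.Fin.Subset
  using (_∈_; _∉_; _⊈_; Nonempty; ⁅_⁆; _∪_; inside; outside)
open import Data.Fin.Subset.Properties
  using ( _∈?_; _⊆?_; nonempty?; Empty-unique; ∣⊥∣≡0; x∈⁅x⁆; x∈⁅y⁆⇒x≡y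
        ; ⊆-trans; ⊆-reflexive; ⊆-antisym; drop-∷-⊆; p⊆q⇒∣p∣≤∣q∣; p⊂q⇒∣p∣<∣q∣
        ; p⊆p∪q; x∈p∪q⁺; x∈p∪q⁻ )
import Data.Nat.Properties as ℕ
open import Data.List using (List; []; _∷_; _++_; map; filter)
open import Data.List.Membership.Propositional using () renaming (_∈_ to _∈ₗ_)
open import Data.List.Membership.Propositional.Properties
  using (∈-++⁺ˡ; ∈-++⁺ʳ; ∈-++⁻; ∈-map⁺; ∈-filter⁺; ∈-filter⁻)
open import Data.List.Properties using (∷-injective)
open import Data.List.Relation.Unary.Any using (here; there)
open import Data.List.Relation.Unary.All as All using (All; []; _∷_)
import Data.List.Relation.Unary.All.Properties as All
open import Data.List.Relation.Unary.AllPairs as AllPairs using (AllPairs; []; _∷_)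
import Data.List.Relation.Unary.AllPairs.Properties as AllPairs
open import Data.Product using (∃-syntax; _×_; _,_; proj₂)
open import Data.Sum using (_⊎_; inj₁; inj₂; [_,_]′)
open import Data.Vec using ([]; _∷_; here)
open import Data.Vec.Properties using (≡-dec)
open import Relation.Binary.Definitions using (DecidableEquality)
open import Relation.Binary.PropositionalEquality using (_≢_; refl; sym; trans; cong; subst)
open import Relation.Nullary using (¬_; yes; no; contradiction)
open import Relation.Nullary.Decidable using (_×-dec_; ¬?; decidable-stable)
open import Relation.Unary using (Pred; Decidable)

private
  variable
    n : ℕ
    p q r s t τ : Subset n
    x : Fin n

infix 4 _≟_
_≟_ : DecidableEquality (Subset n)
_≟_ = ≡-dec Bool._≟_

⊈⇒≢ : q ⊈ p → p ≢ q
⊈⇒≢ q⊈p p≡q = q⊈p (⊆-reflexive (sym p≡q))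

∈∧∉⇒≢ : x ∈ p → x ∉ q → p ≢ q
∈∧∉⇒≢ {x = x} x∈p x∉q p≡q = x∉q (subst (x ∈_) p≡q x∈p)

∪-lub : p ⊆ r → q ⊆ r → p ∪ q ⊆ r
∪-lub {p = p} {q = q} p⊆r q⊆r y∈p∪q = [ p⊆r , q⊆r ]′ (x∈p∪q⁻ p q y∈p∪q)

⁅x⁆⊆ : x ∈ p → ⁅ x ⁆ ⊆ p
⁅x⁆⊆ {x = x} {p = p} x∈p y∈⁅x⁆ = subst (_∈ p) (sym (x∈⁅y⁆⇒x≡y x y∈⁅x⁆)) x∈p

∈p∪⁅x⁆ : x ∈ p ∪ ⁅ x ⁆
∈p∪⁅x⁆ {x = x} = x∈p∪q⁺ (inj₂ (x∈⁅x⁆ x))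

⊆∪⁅x⁆⇒⊆ : p ⊆ q ∪ ⁅ x ⁆ → x ∉ p → p ⊆ q
⊆∪⁅x⁆⇒⊆ {p = p} {q = q} {x = x} p⊆q∪x x∉p {y} y∈p with x∈p∪q⁻ q ⁅ x ⁆ (p⊆q∪x y∈p)
... | inj₁ y∈q   = y∈q
... | inj₂ y∈⁅x⁆ = contradiction (subst (_∈ p) (x∈⁅y⁆⇒x≡y x y∈⁅x⁆) y∈p) x∉p

∪⁅x⁆-cancelʳ : x ∉ p → x ∉ q → p ∪ ⁅ x ⁆ ≡ q ∪ ⁅ x ⁆ → p ≡ q
∪⁅x⁆-cancelʳ {x = x} x∉p x∉q eq = ⊆-antisym (cancel x∉p eq) (cancel x∉q (sym eq))
  where
  cancel : x ∉ s → s ∪ ⁅ x ⁆ ≡ t ∪ ⁅ x ⁆ → s ⊆ t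
  cancel x∉s s∪x≡t∪x = ⊆∪⁅x⁆⇒⊆ (λ y∈s → subst (_ ∈_) s∪x≡t∪x (p⊆p∪q ⁅ x ⁆ y∈s)) x∉s

0<∣p∣⇒Nonempty : ∀ {n} {p : Subset n} → 0 < ∣ p ∣ → Nonempty p
0<∣p∣⇒Nonempty {n = n} {p = p} 0<∣p∣ with nonempty? p
... | yes nonempty = nonempty
... | no  empty    =
  contradiction (trans (cong ∣_∣ (Empty-unique empty)) (∣⊥∣≡0 n)) (ℕ.>⇒≢ 0<∣p∣)

p⊈q⇒∃x∈p∖q : p ⊈ q → ∃[ x ] x ∈ p × x ∉ q
p⊈q⇒∃x∈p∖q {p = p} {q = q} p⊈q with any? (λ x → x ∈? p ×-dec ¬? (x ∈? q))
... | yes witness = witness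
... | no  ∄       = contradiction
  (λ {y} y∈p → decidable-stable (y ∈? q) (λ y∉q → ∄ (y , y∈p , y∉q))) p⊈q

p⊆q∧∣q∣≤∣p∣⇒q⊆p : p ⊆ q → ∣ q ∣ ≤ ∣ p ∣ → q ⊆ p
p⊆q∧∣q∣≤∣p∣⇒q⊆p {p = p} p⊆q ∣q∣≤∣p∣ {y} y∈q with y ∈? p
... | yes y∈p = y∈p
... | no  y∉p = contradiction ∣q∣≤∣p∣ (ℕ.<⇒≱ (p⊂q⇒∣p∣<∣q∣ (p⊆q , y , y∈q , y∉p)))

p⊆q∧1+∣p∣≡∣q∣⇒q≡p∪⁅x⁆ : p ⊆ q → suc ∣ p ∣ ≡ ∣ q ∣ → ∃[ x ] x ∉ p × q ≡ p ∪ ⁅ x ⁆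
p⊆q∧1+∣p∣≡∣q∣⇒q≡p∪⁅x⁆ {p = p} {q = q} p⊆q 1+∣p∣≡∣q∣ with p⊈q⇒∃x∈p∖q q⊈p
  where
  q⊈p : q ⊈ p
  q⊈p q⊆p = ℕ.1+n≰n (subst (_≤ ∣ p ∣) (sym 1+∣p∣≡∣q∣) (p⊆q⇒∣p∣≤∣q∣ q⊆p))
... | x , x∈q , x∉p = x , x∉p , ⊆-antisym (p⊆q∧∣q∣≤∣p∣⇒q⊆p p∪x⊆q ∣q∣≤∣p∪x∣) p∪x⊆q
  where
  p∪x⊆q : p ∪ ⁅ x ⁆ ⊆ q
  p∪x⊆q = ∪-lub p⊆q (⁅x⁆⊆ x∈q)
  ∣q∣≤∣p∪x∣ : ∣ q ∣ ≤ ∣ p ∪ ⁅ x ⁆ ∣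
  ∣q∣≤∣p∪x∣ = subst (_≤ _) 1+∣p∣≡∣q∣ (p⊂q⇒∣p∣<∣q∣ (p⊆p∪q ⁅ x ⁆ , x , ∈p∪⁅x⁆ , x∉p))

subsets : ∀ n → List (Subset n)
subsets 0       = [] ∷ []
subsets (suc n) = map (outside ∷_) (subsets n) ++ map (inside ∷_) (subsets n)

∈-subsets : ∀ (p : Subset n) → p ∈ₗ subsets n
∈-subsets []            = here refl
∈-subsets (outside ∷ p) = ∈-++⁺ˡ (∈-map⁺ (outside ∷_) (∈-subsets p))
∈-subsets {suc n} (inside ∷ p) =
  ∈-++⁺ʳ (map (outside ∷_) (subsets n)) (∈-map⁺ (inside ∷_) (∈-subsets p))

subsets-sorted : ∀ n → AllPairs (λ p q → q ⊈ p) (subsets n)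
subsets-sorted 0       = [] ∷ []
subsets-sorted (suc n) = AllPairs.++⁺ (cons (subsets-sorted n)) (cons (subsets-sorted n))
  (All.map⁺ (All.tabulate λ _ → All.map⁺ (All.tabulate λ _ i∷q⊆o∷p → out (i∷q⊆o∷p here))))
  where
  cons : ∀ {s} → AllPairs (λ p q → q ⊈ p) (subsets n) →
         AllPairs (λ p q → q ⊈ p) (map (s ∷_) (subsets n))
  cons sorted = AllPairs.map⁺ (AllPairs.map (λ q⊈p → q⊈p ∘ drop-∷-⊆) sorted)
  out : ∀ {p : Subset n} → ¬ (zero ∈ outside ∷ p)
  out ()

module _ {a} {A : Set a} where

  ∈-++∷⁻ : ∀ (pre : List A) {g x suf} → x ∈ₗ pre ++ g ∷ suf → x ∈ₗ pre ⊎ x ≡ g ⊎ x ∈ₗ suf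
  ∈-++∷⁻ pre x∈ with ∈-++⁻ pre x∈
  ... | inj₁ x∈pre         = inj₁ x∈pre
  ... | inj₂ (here x≡g)    = inj₂ (inj₁ x≡g)
  ... | inj₂ (there x∈suf) = inj₂ (inj₂ x∈suf)

  module _ {ℓ} {R : A → A → Set ℓ} where

    AllPairs-++∷⁻ : ∀ (pre : List A) {g suf} → AllPairs R (pre ++ g ∷ suf) →
                    All (λ h → R h g) pre × All (R g) suf
    AllPairs-++∷⁻ []        (Rg ∷ _)      = [] , Rg
    AllPairs-++∷⁻ (h ∷ pre) (Rh ∷ sorted) with AllPairs-++∷⁻ pre sorted
    ... | before , after with All.++⁻ʳ pre Rh
    ...   | Rhg ∷ _ = Rhg ∷ before , after

    AllPairs-filter⁺ : ∀ {p} {P : Pred A p} (P? : Decidable P) {xs} →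
                       AllPairs (λ x y → P x → P y → R x y) xs → AllPairs R (filter P? xs)
    AllPairs-filter⁺ {P = P} P? {xs} sorted =
      discharge (All.all-filter P? xs) (AllPairs.filter⁺ P? sorted)
      where
      discharge : ∀ {ys} → All P ys → AllPairs (λ x y → P x → P y → R x y) ys → AllPairs R ys
      discharge []         []           = []
      discharge (Px ∷ Pxs) (Rx ∷ sorted) =
        All.zipWith (λ (Py , Rxy) → Rxy Px Py) (Pxs , Rx) ∷ discharge Pxs sorted

Comparable : Subset n → Subset n → Set
Comparable s t = s ⊆ t ⊎ t ⊆ s

≡⊎ΓAdj⇒comparable : s ≡ t ⊎ ΓAdj s t → Comparable s t
≡⊎ΓAdj⇒comparable (inj₁ refl)            = inj₁ (λ x∈s → x∈s)
≡⊎ΓAdj⇒comparable (inj₂ (_ , comparable)) = comparable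

comparable⇒≡⊎ΓAdj : Comparable s t → s ≡ t ⊎ ΓAdj s t
comparable⇒≡⊎ΓAdj {s = s} {t = t} comparable with s ≟ t
... | yes s≡t = inj₁ s≡t
... | no  s≢t = inj₂ (s≢t , comparable)

-- DominatedIn carries a level parameter it does not use; Dismantlable fixes it to 0ℓ here.
dominatedIn-if-comparable : ∀ (W : List (Subset n)) {g g'} → g' ≢ g →
  (∀ {h} → h ∈ₗ W → Comparable h g → Comparable h g') → DominatedIn {c = 0ℓ} ΓAdj W g g'
dominatedIn-if-comparable W g'≢g comparable =
  g'≢g , λ h (h∈W , h∈N[g]) →
    h∈W , comparable⇒≡⊎ΓAdj (comparable h∈W (≡⊎ΓAdj⇒comparable h∈N[g]))

module Dismantling {n} (v : Fin n) {W : Subset n → Set} (W? : Decidable W)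
            (W⁅v⁆ : W ⁅ v ⁆) (W-∪⁅v⁆ : ∀ {g} → W g → v ∉ g → W (g ∪ ⁅ v ⁆)) where

  Containing Avoiding : Subset n → Set
  Containing s = W s × v ∈ s × s ≢ ⁅ v ⁆
  Avoiding   s = W s × v ∉ s

  Containing? : Decidable Containing
  Containing? s = W? s ×-dec v ∈? s ×-dec ¬? (s ≟ ⁅ v ⁆)

  Avoiding? : Decidable Avoiding
  Avoiding? s = W? s ×-dec ¬? (v ∈? s)

  containing avoiding ordering : List (Subset n)
  containing = filter Containing? (subsets n)
  avoiding   = filter Avoiding? (subsets n)
  ordering = ⁅ v ⁆ ∷ containing ++ avoiding

  -- Sets containing v come first; a set avoiding v is never preceded by a superset.
  _≺_ : Subset n → Subset n → Set
  s ≺ t = v ∈ s × s ≢ t ⊎ v ∉ t × t ⊈ s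

  ≺⇒≢ : s ≺ t → s ≢ t
  ≺⇒≢ (inj₁ (_ , s≢t)) = s≢t
  ≺⇒≢ (inj₂ (_ , t⊈s)) = ⊈⇒≢ t⊈s

  ∈containing++avoiding⁻ : ∀ {s} → s ∈ₗ containing ++ avoiding → Containing s ⊎ Avoiding s
  ∈containing++avoiding⁻ s∈ with ∈-++⁻ containing s∈
  ... | inj₁ s∈containing = inj₁ (proj₂ (∈-filter⁻ Containing? {xs = subsets n} s∈containing))
  ... | inj₂ s∈avoiding   = inj₂ (proj₂ (∈-filter⁻ Avoiding? {xs = subsets n} s∈avoiding))

  ordering-sound : ∀ s → s ∈ₗ ordering → W s
  ordering-sound s (here refl) = W⁅v⁆
  ordering-sound s (there s∈) with ∈containing++avoiding⁻ s∈
  ... | inj₁ (Ws , _) = Ws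
  ... | inj₂ (Ws , _) = Ws

  ordering-complete : ∀ s → W s → s ∈ₗ ordering
  ordering-complete s Ws with v ∈? s | s ≟ ⁅ v ⁆
  ... | yes _   | yes refl  = here refl
  ... | yes v∈s | no  s≢⁅v⁆ =
    there (∈-++⁺ˡ (∈-filter⁺ Containing? (∈-subsets s) (Ws , v∈s , s≢⁅v⁆)))
  ... | no  v∉s | _         =
    there (∈-++⁺ʳ containing (∈-filter⁺ Avoiding? (∈-subsets s) (Ws , v∉s)))

  ordering-sorted : AllPairs _≺_ ordering
  ordering-sorted = All.tabulate (apex≺ ∘ ∈containing++avoiding⁻) ∷ AllPairs.++⁺
    (AllPairs-filter⁺ Containing?
      (AllPairs.map (λ t⊈s (_ , v∈s , _) _ → inj₁ (v∈s , ⊈⇒≢ t⊈s)) (subsets-sorted n)))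
    (AllPairs-filter⁺ Avoiding?
      (AllPairs.map (λ t⊈s _ (_ , v∉t) → inj₂ (v∉t , t⊈s)) (subsets-sorted n)))
    (All.tabulate λ s∈ → All.tabulate λ t∈ →
      containing≺avoiding (proj₂ (∈-filter⁻ Containing? {xs = subsets n} s∈))
                          (proj₂ (∈-filter⁻ Avoiding? {xs = subsets n} t∈)))
    where
    containing≺avoiding : ∀ {s t} → Containing s → Avoiding t → s ≺ t
    containing≺avoiding (_ , v∈s , _) (_ , v∉t) = inj₁ (v∈s , ∈∧∉⇒≢ v∈s v∉t)
    apex≺ : ∀ {t} → Containing t ⊎ Avoiding t → ⁅ v ⁆ ≺ t
    apex≺ (inj₁ (_ , _ , t≢⁅v⁆)) = inj₁ (x∈⁅x⁆ v , t≢⁅v⁆ ∘ sym)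
    apex≺ (inj₂ (_ , v∉t))       = inj₁ (x∈⁅x⁆ v , ∈∧∉⇒≢ (x∈⁅x⁆ v) v∉t)

  ≺-∈ : v ∈ t → s ≺ t → v ∈ s
  ≺-∈ _   (inj₁ (v∈s , _)) = v∈s
  ≺-∈ v∈t (inj₂ (v∉t , _)) = contradiction v∈t v∉t

  ∈-++[]⁻ : ∀ {pre g h} → All (_≺ g) pre → h ∈ₗ pre ++ g ∷ [] → h ≺ g ⊎ h ≡ g
  ∈-++[]⁻ {pre} before h∈ with ∈-++∷⁻ pre h∈
  ... | inj₁ h∈pre       = inj₁ (All.lookup before h∈pre)
  ... | inj₂ (inj₁ h≡g)  = inj₂ h≡g
  ... | inj₂ (inj₂ ())

  apex-dominates : ∀ {pre g} → v ∈ g → ⁅ v ⁆ ≢ g → All (_≺ g) pre →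
                   DominatedIn {c = 0ℓ} ΓAdj (pre ++ g ∷ []) g ⁅ v ⁆
  apex-dominates {pre} {g} v∈g ⁅v⁆≢g before = dominatedIn-if-comparable (pre ++ g ∷ []) ⁅v⁆≢g
    λ h∈ _ → inj₂ (⁅x⁆⊆ (v∈ (∈-++[]⁻ before h∈)))
    where
    v∈ : ∀ {h} → h ≺ g ⊎ h ≡ g → v ∈ h
    v∈ (inj₁ h≺g)  = ≺-∈ v∈g h≺g
    v∈ (inj₂ refl) = v∈g

  ∪⁅v⁆-dominates : ∀ {pre g} → v ∉ g → All (_≺ g) pre →
                   DominatedIn {c = 0ℓ} ΓAdj (pre ++ g ∷ []) g (g ∪ ⁅ v ⁆)
  ∪⁅v⁆-dominates {pre} {g} v∉g before = dominatedIn-if-comparable (pre ++ g ∷ []) g∪⁅v⁆≢g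
    λ h∈ → comparable (∈-++[]⁻ before h∈)
    where
    g∪⁅v⁆≢g : g ∪ ⁅ v ⁆ ≢ g
    g∪⁅v⁆≢g = ∈∧∉⇒≢ ∈p∪⁅x⁆ v∉g
    comparable : ∀ {h} → h ≺ g ⊎ h ≡ g → Comparable h g → Comparable h (g ∪ ⁅ v ⁆)
    comparable (inj₂ refl)              _            = inj₁ (p⊆p∪q ⁅ v ⁆)
    comparable (inj₁ (inj₁ (v∈h , _))) (inj₁ h⊆g)   = contradiction (h⊆g v∈h) v∉g
    comparable (inj₁ (inj₁ (v∈h , _))) (inj₂ g⊆h)   = inj₂ (∪-lub g⊆h (⁅x⁆⊆ v∈h))
    comparable (inj₁ (inj₂ _))          (inj₁ h⊆g)   = inj₁ (⊆-trans h⊆g (p⊆p∪q ⁅ v ⁆))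
    comparable (inj₁ (inj₂ (_ , g⊈h)))  (inj₂ g⊆h)   = contradiction (λ {y} → g⊆h {y}) g⊈h

  ordering-dismantling : DismantlingOrder {c = 0ℓ} ΓAdj ordering
  ordering-dismantling []        _ _   _  []≢[] = contradiction refl []≢[]
  ordering-dismantling (p ∷ pre) g suf eq _ with ∷-injective eq
  ... | refl , _ with AllPairs-++∷⁻ (p ∷ pre) (subst (AllPairs _≺_) eq ordering-sorted) | v ∈? g
  ... | before@(⁅v⁆≺g ∷ _) , _ | yes v∈g = p , here refl , apex-dominates v∈g (≺⇒≢ ⁅v⁆≺g) before
  ... | before , after | no v∉g with ∈-++∷⁻ (p ∷ pre) (subst (g ∪ ⁅ v ⁆ ∈ₗ_) eq g∪⁅v⁆∈ordering)
    where
    g∈ordering : g ∈ₗ ordering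
    g∈ordering = subst (g ∈ₗ_) (sym eq) (∈-++⁺ʳ (p ∷ pre) (here refl))
    g∪⁅v⁆∈ordering : g ∪ ⁅ v ⁆ ∈ₗ ordering
    g∪⁅v⁆∈ordering = ordering-complete (g ∪ ⁅ v ⁆) (W-∪⁅v⁆ (ordering-sound g g∈ordering) v∉g)
  ...   | inj₁ g∪⁅v⁆∈pre        = g ∪ ⁅ v ⁆ , g∪⁅v⁆∈pre , ∪⁅v⁆-dominates v∉g before
  ...   | inj₂ (inj₁ g∪⁅v⁆≡g)   = contradiction g∪⁅v⁆≡g (∈∧∉⇒≢ (∈p∪⁅x⁆ {p = g}) v∉g)
  ...   | inj₂ (inj₂ g∪⁅v⁆∈suf) =
    contradiction (≺-∈ (∈p∪⁅x⁆ {p = g}) (All.lookup after g∪⁅v⁆∈suf)) v∉g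

∪⁅x⁆-closed⇒dismantlable : ∀ {W : Subset n → Set} → Decidable W → W ⁅ x ⁆ →
  (∀ {g} → W g → x ∉ g → W (g ∪ ⁅ x ⁆)) → Dismantlable ΓAdj W
∪⁅x⁆-closed⇒dismantlable {x = x} W? W⁅x⁆ W-∪⁅x⁆ = inj₂
  ( ordering , AllPairs.map ≺⇒≢ ordering-sorted
  , ordering-complete , ordering-sound , ordering-dismantling )
  where open Dismantling x W? W⁅x⁆ W-∪⁅x⁆

InKστ? : ∀ (σ τ : Subset n) → Decidable (InKστ σ τ)
InKστ? σ τ s = (nonempty? s ×-dec s ⊆? σ) ×-dec ¬? (s ≟ σ) ×-dec ¬? (s ≟ τ)

InKστ-∪⁅x⁆-dismantlable : x ∉ τ → Nonempty τ → Dismantlable ΓAdj (InKστ (τ ∪ ⁅ x ⁆) τ)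
InKστ-∪⁅x⁆-dismantlable {x = x} {τ = τ} x∉τ (y , y∈τ) =
  ∪⁅x⁆-closed⇒dismantlable (InKστ? (τ ∪ ⁅ x ⁆) τ) apex add-x
  where
  ⁅x⁆≢τ∪⁅x⁆ : ⁅ x ⁆ ≢ τ ∪ ⁅ x ⁆
  ⁅x⁆≢τ∪⁅x⁆ eq =
    x∉τ (subst (_∈ τ) (x∈⁅y⁆⇒x≡y x (subst (y ∈_) (sym eq) (p⊆p∪q ⁅ x ⁆ y∈τ))) y∈τ)
  apex : InKστ (τ ∪ ⁅ x ⁆) τ ⁅ x ⁆
  apex = ((x , x∈⁅x⁆ x) , ⁅x⁆⊆ ∈p∪⁅x⁆) , ⁅x⁆≢τ∪⁅x⁆ , ∈∧∉⇒≢ (x∈⁅x⁆ x) x∉τ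
  add-x : ∀ {g} → InKστ (τ ∪ ⁅ x ⁆) τ g → x ∉ g → InKστ (τ ∪ ⁅ x ⁆) τ (g ∪ ⁅ x ⁆)
  add-x {g} (((z , z∈g) , g⊆τ∪⁅x⁆) , _ , g≢τ) x∉g =
    ((z , p⊆p∪q ⁅ x ⁆ z∈g) , ∪-lub g⊆τ∪⁅x⁆ (⁅x⁆⊆ ∈p∪⁅x⁆)) ,
    g≢τ ∘ ∪⁅x⁆-cancelʳ x∉g x∉τ ,
    ∈∧∉⇒≢ (∈p∪⁅x⁆ {p = g}) x∉τ

lemma2p5 : (n : ℕ) (K : SimplicialComplex n) (σ τ : Subset n) →
           IsFace K σ → 2 ≤ ∣ σ ∣ → τ ⊆ σ → suc (∣ τ ∣) ≡ (∣ σ ∣) →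
           Dismantlable ΓAdj (InKστ σ τ)
lemma2p5 n K σ τ _ 2≤∣σ∣ τ⊆σ 1+∣τ∣≡∣σ∣ with p⊆q∧1+∣p∣≡∣q∣⇒q≡p∪⁅x⁆ τ⊆σ 1+∣τ∣≡∣σ∣
... | x , x∉τ , refl =
  InKστ-∪⁅x⁆-dismantlable x∉τ (0<∣p∣⇒Nonempty (s≤s⁻¹ (subst (2 ≤_) (sym 1+∣τ∣≡∣σ∣) 2≤∣σ∣)))
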